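{- There exists a $3$-way $4$-homogeneous $(v,3,2)$ Steiner trade if and only if $v\ge 9$ and $v\equiv 0\pmod 3$.
   Context: Let $V$ be a finite set with $v$ elements and let $t<k<v$ be positive integers. A $\mu$-way $(v,k,t)$ trade $T=\{T_1,\dots,T_\mu\}$ of volume $m$ consists of $\mu$ pairwise disjoint collections $T_1,\dots,T_\mu$, each of $m$ blocks ($k$-subsets of $V$), such that every $t$-subset of $V$ is contained in the same number of blocks in each $T_i$. The foundation $\mathrm{found}(T)$ is the set of elements covered by the blocks. It is a Steiner trade if every $t$-subset of $\mathrm{found}(T)$ is in at most one block of each $T_i$, and $d$-homogeneous if every element of $V$ lies in exactly $d$ blocks of each $T_i$. -}

module Defs where

open import Data.Nat using (ℕ; _≤_)
open import Data.Fin using (Fin)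
open import Data.Fin.Subset using (Subset; _⊆_; _∈_; ∣_∣)
open import Data.Fin.Subset.Properties using (_⊆?_; _∈?_)
open import Data.List using (List; length; filter)
open import Data.List.Relation.Unary.All using (All)
open import Data.List.Relation.Unary.Unique.Propositional using (Unique)
import Data.List.Membership.Propositional as LM
open import Data.Product using (∃; ∃-syntax; _×_)
open import Relation.Binary.PropositionalEquality using (_≡_; _≢_)
open import Relation.Nullary using (¬_)

countContaining : ∀ {v} → Subset v → List (Subset v) → ℕ
countContaining S Bs = length (filter (λ B → S ⊆? B) Bs)

countPoint : ∀ {v} → Fin v → List (Subset v) → ℕ
countPoint x Bs = length (filter (λ B → x ∈? B) Bs)

record Trade (μ v k t : ℕ) : Set where
  field
    blocks   : Fin μ → List (Subset v)
    volume   : ℕ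
    size     : ∀ i → length (blocks i) ≡ volume
    distinct : ∀ i → Unique (blocks i)
    isBlock  : ∀ i → All (λ B → ∣ B ∣ ≡ k) (blocks i)
    disjoint : ∀ i j → i ≢ j → ∀ B → B LM.∈ blocks i → ¬ (B LM.∈ blocks j)
    balanced : ∀ (S : Subset v) → ∣ S ∣ ≡ t → ∀ i j →
               countContaining S (blocks i) ≡ countContaining S (blocks j)

  InFound : Fin v → Set
  InFound x = ∃[ i ] ∃[ B ] (B LM.∈ blocks i × x ∈ B)

open Trade public

IsSteiner : ∀ {μ v k t} → Trade μ v k t → Set
IsSteiner {v = v} {t = t} T =
  ∀ (S : Subset v) → ∣ S ∣ ≡ t → (∀ x → x ∈ S → InFound T x) →
  ∀ i → countContaining S (blocks T i) ≤ 1

IsHomogeneous : ∀ {μ v k t} → ℕ → Trade μ v k t → Set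
IsHomogeneous {v = v} d T = ∀ (x : Fin v) i → countPoint x (blocks T i) ≡ d

module Submission where

-- Necessity (modules Necessity and the one after it) is double counting inside the
-- first collection T₁: the incidences give 4v = 3|T₁|, hence 3 ∣ v; every point is
-- covered (4 > 0), so the Steiner condition applies to all pairs, and the 4 blocks
-- through the point 0 contain 8 further points, all distinct, so v ≥ 9.
--
-- Sufficiency is constructive: the disjoint union of trades on a and b points is a
-- trade on a + b points ('union'), and explicit trades on 9, 12 and 15 points are
-- proved correct by evaluating a decision procedure for a finite list of conditions
-- ('Certificate').  Every v = 3q with q ≥ 3 is 9, 12 or 15 plus a multiple of 9.

open import Defs
open import Data.Nat using (ℕ; _<_; _≤_; _%_)
open import Data.Product using (∃-syntax; _×_)
open import Function.Bundles using (_⇔_)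
open import Relation.Binary.PropositionalEquality using (_≡_)

open import Data.Bool using (Bool; true; false; T; _∧_)
import Data.Bool as Bool
open import Data.Bool.Properties using (T-≡; T-∧; ∧-idem; ∧-identityʳ; ∧-zeroʳ)
open import Data.Empty using (⊥-elim)
open import Data.Fin using (Fin; zero; suc; _↑ˡ_; _↑ʳ_; splitAt)
import Data.Fin as Fin
open import Data.Fin.Properties using (all?; splitAt⁻¹-↑ˡ; splitAt⁻¹-↑ʳ) renaming (suc-injective to fsuc-injective)
open import Data.Fin.Subset using (Subset; _⊆_; _∈_; ∣_∣; ⁅_⁆; _∪_; ⊥)
open import Data.Fin.Subset.Properties
  using (_⊆?_; _∈?_; ⊆-min; p⊆q⇒∣p∣≤∣q∣; ∣⊥∣≡0; x∈⁅x⁆; x∈⁅y⁆⇒x≡y; x∈p∪q⁺; x∈p∪q⁻; ∪-identityˡ; ∣⁅x⁆∣≡1)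
open import Data.List using (List; []; _∷_; length; filter; map) renaming (_++_ to _++ₗ_)
import Data.List.Membership.Propositional as List
open import Data.List.Membership.Propositional.Properties using (∈-++⁻; ∈-map⁻)
open import Data.List.Properties using (length-++; length-map)
open import Data.List.Relation.Unary.All using (All; []; _∷_)
import Data.List.Relation.Unary.All as All
import Data.List.Relation.Unary.All.Properties as All
open import Data.List.Relation.Unary.Any using (here; there)
open import Data.List.Relation.Unary.Unique.Propositional using (Unique)
import Data.List.Relation.Unary.Unique.Propositional.Properties as Unique
open import Data.Nat using (zero; suc; _+_; _*_; _∸_; z≤n; s≤s)
import Data.Nat as ℕ
open import Data.Nat.Divisibility using (divides; m%n≡0⇒n∣m)
open import Data.Nat.DivMod using ([m+kn]%n≡m%n; m*n%n≡0)
open import Data.Nat.Properties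
  using ( +-0-commutativeMonoid; +-identityʳ; +-assoc; *-zeroʳ; *-distribʳ-+; *-suc; 1+n≢0
        ; suc-injective; n≤0⇒n≡0; _≤?_; +-mono-≤; +-monoʳ-≤; +-cancelˡ-≤; *-cancelʳ-≤; m+[n∸m]≡n
        ; module ≤-Reasoning)
open import Algebra.Properties.CommutativeMonoid.Sum +-0-commutativeMonoid
  using (sum; ∑-distrib-+; sum-cong-≗)
open import Data.Nat.Tactic.RingSolver using (solve-∀)
open import Data.Product using (_,_; Σ)
open import Data.Sum using (_⊎_; inj₁; inj₂)
open import Data.Unit using (tt)
open import Data.Vec using ([]; _∷_; lookup; _++_)
import Data.Vec as Vec
open import Data.Vec.Properties
  using (≡-dec; []=⇒lookup; lookup⇒[]=; lookup-++ˡ; lookup-++ʳ; lookup-replicate; ++-injectiveˡ; ++-injectiveʳ)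
open import Function.Bundles using (mk⇔; Equivalence)
open import Level using (0ℓ)
open import Relation.Binary.PropositionalEquality
  using (_≢_; refl; sym; trans; cong; cong₂; subst; module ≡-Reasoning)
open import Relation.Nullary using (Dec; does; ¬_; ¬?)
open import Relation.Nullary.Decidable using (dec-true; dec-false; _×-dec_; _→-dec_; toWitness)
open import Relation.Unary using (Pred; Decidable)

ind : Bool → ℕ
ind true  = 1
ind false = 0

count : {A : Set} → (A → Bool) → List A → ℕ
count f []       = 0
count f (x ∷ xs) = ind (f x) + count f xs

does-≡ : {A : Set} {b : Bool} (a? : Dec A) → A ⇔ T b → does a? ≡ b
does-≡ {b = true}  a? A⇔b = dec-true a? (Equivalence.from A⇔b tt)
does-≡ {b = false} a? A⇔b = dec-false a? (Equivalence.to A⇔b)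

length-filter : {A : Set} {P : Pred A 0ℓ} (P? : Decidable P) (f : A → Bool) →
                (∀ x → does (P? x) ≡ f x) → ∀ xs → length (filter P? xs) ≡ count f xs
length-filter P? f P?≡f [] = refl
length-filter P? f P?≡f (x ∷ xs) rewrite sym (P?≡f x) with does (P? x)
... | true  = cong suc (length-filter P? f P?≡f xs)
... | false = length-filter P? f P?≡f xs

count-cong : {A : Set} {f g : A → Bool} → (∀ x → f x ≡ g x) → ∀ xs → count f xs ≡ count g xs
count-cong f≡g []       = refl
count-cong f≡g (x ∷ xs) = cong₂ _+_ (cong ind (f≡g x)) (count-cong f≡g xs)

count-witness : {A : Set} (f : A → Bool) (xs : List A) → ¬ count f xs ≡ 0 →
                ∃[ x ] (x List.∈ xs × f x ≡ true)
count-witness f []       count≢0 = ⊥-elim (count≢0 refl)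
count-witness f (x ∷ xs) count≢0 with f x in fx
... | true  = x , here refl , fx
... | false with count-witness f xs count≢0
...   | y , y∈xs , fy = y , there y∈xs , fy

count-++ : {A : Set} (f : A → Bool) (xs ys : List A) → count f (xs ++ₗ ys) ≡ count f xs + count f ys
count-++ f []       ys = refl
count-++ f (x ∷ xs) ys = trans (cong (ind (f x) +_) (count-++ f xs ys)) (sym (+-assoc (ind (f x)) _ _))

count-map : {A B : Set} (f : B → Bool) (g : A → B) (xs : List A) → count f (map g xs) ≡ count (λ x → f (g x)) xs
count-map f g []       = refl
count-map f g (x ∷ xs) = cong (ind (f (g x)) +_) (count-map f g xs)

count-none : {A : Set} {f : A → Bool} → (∀ x → f x ≡ false) → (xs : List A) → count f xs ≡ 0
count-none f≡false []       = refl
count-none f≡false (x ∷ xs) rewrite f≡false x = count-none f≡false xs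

nonzero : ∀ {m n} → m ≡ suc n → ¬ m ≡ 0
nonzero refl ()

∈⇔lookup : ∀ {n} (x : Fin n) (B : Subset n) → x ∈ B ⇔ T (lookup B x)
∈⇔lookup x B = mk⇔ (λ x∈B → Equivalence.from T-≡ ([]=⇒lookup x∈B))
                   (λ t → lookup⇒[]= x B (Equivalence.to T-≡ t))

pair⊆⇔ : ∀ {n} (x y : Fin n) (B : Subset n) → ⁅ x ⁆ ∪ ⁅ y ⁆ ⊆ B ⇔ T (lookup B x ∧ lookup B y)
pair⊆⇔ x y B = mk⇔ both-in pair-in
  where
  open Equivalence
  both-in : ⁅ x ⁆ ∪ ⁅ y ⁆ ⊆ B → T (lookup B x ∧ lookup B y)
  both-in xy⊆B = from T-∧ ( to (∈⇔lookup x B) (xy⊆B (x∈p∪q⁺ (inj₁ (x∈⁅x⁆ x))))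
                          , to (∈⇔lookup y B) (xy⊆B (x∈p∪q⁺ (inj₂ (x∈⁅x⁆ y)))))
  pair-in : T (lookup B x ∧ lookup B y) → ⁅ x ⁆ ∪ ⁅ y ⁆ ⊆ B
  pair-in both z∈xy with to T-∧ both | x∈p∪q⁻ ⁅ x ⁆ ⁅ y ⁆ z∈xy
  ... | x∈B , _ | inj₁ z∈x = subst (_∈ B) (sym (x∈⁅y⁆⇒x≡y x z∈x)) (from (∈⇔lookup x B) x∈B)
  ... | _ , y∈B | inj₂ z∈y = subst (_∈ B) (sym (x∈⁅y⁆⇒x≡y y z∈y)) (from (∈⇔lookup y B) y∈B)

degree : ∀ {n} → Fin n → List (Subset n) → ℕ
degree x = count (λ B → lookup B x)

codegree : ∀ {n} → Fin n → Fin n → List (Subset n) → ℕ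
codegree x y = count (λ B → lookup B x ∧ lookup B y)

countPoint≡degree : ∀ {n} (x : Fin n) Bs → countPoint x Bs ≡ degree x Bs
countPoint≡degree x = length-filter (x ∈?_) _ (λ B → does-≡ (x ∈? B) (∈⇔lookup x B))

countPair≡codegree : ∀ {n} (x y : Fin n) Bs → countContaining (⁅ x ⁆ ∪ ⁅ y ⁆) Bs ≡ codegree x y Bs
countPair≡codegree x y = length-filter (⁅ x ⁆ ∪ ⁅ y ⁆ ⊆?_) _ (λ B → does-≡ (⁅ x ⁆ ∪ ⁅ y ⁆ ⊆? B) (pair⊆⇔ x y B))

sum-const : ∀ n c → sum {n} (λ _ → c) ≡ n * c
sum-const zero    c = refl
sum-const (suc n) c = cong (c +_) (sum-const n c)

sum-bounded : ∀ n (f : Fin n → ℕ) → (∀ x → f x ≤ 1) → sum f ≤ n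
sum-bounded zero    f f≤1 = z≤n
sum-bounded (suc n) f f≤1 = +-mono-≤ (f≤1 zero) (sum-bounded n (λ x → f (suc x)) (λ x → f≤1 (suc x)))

sum-lookup : ∀ {n} (B : Subset n) → sum (λ y → ind (lookup B y)) ≡ ∣ B ∣
sum-lookup []          = refl
sum-lookup (true ∷ B)  = cong suc (sum-lookup B)
sum-lookup (false ∷ B) = sum-lookup B

-- Double counting of incidences (y, B) with y ∈ B and w B, when all blocks have 3 points:
-- each such block contributes exactly 3.
sum-incidences : ∀ {n} (w : Subset n → Bool) Bs → All (λ B → ∣ B ∣ ≡ 3) Bs →
                 sum (λ y → count (λ B → w B ∧ lookup B y) Bs) ≡ count w Bs * 3
sum-incidences {n} w []       []             = trans (sum-const n 0) (*-zeroʳ n)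
sum-incidences {n} w (B ∷ Bs) (∣B∣≡3 ∷ ∣Bs∣≡3) = begin
  sum (λ y → ind (w B ∧ lookup B y) + count (λ B → w B ∧ lookup B y) Bs)
    ≡⟨ ∑-distrib-+ (λ y → ind (w B ∧ lookup B y)) _ ⟩
  sum (λ y → ind (w B ∧ lookup B y)) + sum (λ y → count (λ B → w B ∧ lookup B y) Bs)
    ≡⟨ cong₂ _+_ (block-contribution (w B)) (sum-incidences w Bs ∣Bs∣≡3) ⟩
  ind (w B) * 3 + count w Bs * 3
    ≡⟨ *-distribʳ-+ 3 (ind (w B)) (count w Bs) ⟨
  count w (B ∷ Bs) * 3 ∎
  where
  open ≡-Reasoning
  block-contribution : ∀ b → sum (λ y → ind (b ∧ lookup B y)) ≡ ind b * 3
  block-contribution true  = trans (sum-lookup B) (trans ∣B∣≡3 refl)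
  block-contribution false = trans (sum-const n 0) (*-zeroʳ n)

module Necessity {v : ℕ} (T : Trade 3 v 3 2) (hom : IsHomogeneous 4 T) where

  T₁ : List (Subset v)
  T₁ = blocks T zero

  degree-four : ∀ x → degree x T₁ ≡ 4
  degree-four x = trans (sym (countPoint≡degree x T₁)) (hom x zero)

  everywhere-found : ∀ x → InFound T x
  everywhere-found x with count-witness (λ B → lookup B x) T₁ (λ deg≡0 → 1+n≢0 (trans (sym (degree-four x)) deg≡0))
  ... | B , B∈T₁ , x∈B = zero , B , B∈T₁ , lookup⇒[]= x B x∈B

  incidences : v * 4 ≡ length T₁ * 3
  incidences = begin
    v * 4                      ≡⟨ sum-const v 4 ⟨
    sum {v} (λ _ → 4)          ≡⟨ sum-cong-≗ (λ x → sym (degree-four x)) ⟩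
    sum (λ x → degree x T₁)    ≡⟨ sum-incidences (λ _ → true) T₁ (isBlock T zero) ⟩
    count (λ _ → true) T₁ * 3  ≡⟨ cong (_* 3) (count-true T₁) ⟩
    length T₁ * 3              ∎
    where
    open ≡-Reasoning
    count-true : (Bs : List (Subset v)) → count (λ _ → true) Bs ≡ length Bs
    count-true []       = refl
    count-true (_ ∷ Bs) = cong suc (count-true Bs)

  divisible : v % 3 ≡ 0
  divisible = begin
    v % 3              ≡⟨ [m+kn]%n≡m%n v v 3 ⟨
    (v + v * 3) % 3    ≡⟨ cong (_% 3) (*-suc v 3) ⟨
    v * 4 % 3          ≡⟨ cong (_% 3) incidences ⟩
    length T₁ * 3 % 3  ≡⟨ m*n%n≡0 (length T₁) 3 ⟩
    0                  ∎
    where open ≡-Reasoning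

-- Necessity of v ≥ 9: summing over y the number of blocks of T₁ through 0 and y gives
-- 4 · 3 = 12; the term y = 0 is 4, and by the Steiner property every other term is ≤ 1.
module _ {n : ℕ} (T : Trade 3 (suc n) 3 2) (steiner : IsSteiner T) (hom : IsHomogeneous 4 T) where
  open Necessity T hom

  through-zero : Fin (suc n) → ℕ
  through-zero y = codegree zero y T₁

  through-zero-total : sum through-zero ≡ 12
  through-zero-total =
    trans (sum-incidences (λ B → lookup B zero) T₁ (isBlock T zero)) (cong (_* 3) (degree-four zero))

  through-zero-self : through-zero zero ≡ 4
  through-zero-self = trans (count-cong (λ B → ∧-idem (lookup B zero)) T₁) (degree-four zero)

  through-zero-other : ∀ y → through-zero (suc y) ≤ 1
  through-zero-other y = subst (_≤ 1) (countPair≡codegree zero (suc y) T₁)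
    (steiner (⁅ zero ⁆ ∪ ⁅ suc y ⁆) pair-size (λ x _ → everywhere-found x) zero)
    where
    pair-size : ∣ ⁅ zero ⁆ ∪ ⁅ suc y ⁆ ∣ ≡ 2
    pair-size rewrite ∪-identityˡ ⁅ y ⁆ = cong suc (∣⁅x⁆∣≡1 y)

  at-least-nine : 9 ≤ suc n
  at-least-nine = s≤s (+-cancelˡ-≤ 4 8 n (begin
    12                                  ≡⟨ through-zero-total ⟨
    through-zero zero + sum others      ≡⟨ cong (_+ sum others) through-zero-self ⟩
    4 + sum others                      ≤⟨ +-monoʳ-≤ 4 (sum-bounded n others through-zero-other) ⟩
    4 + n                               ∎))
    where
    open ≤-Reasoning
    others : Fin n → ℕ
    others y = through-zero (suc y)

_⊆ᵇ_ : ∀ {n} → Subset n → Subset n → Bool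
S ⊆ᵇ B = does (S ⊆? B)

countContaining≡count : ∀ {n} (S : Subset n) Bs → countContaining S Bs ≡ count (S ⊆ᵇ_) Bs
countContaining≡count S = length-filter (S ⊆?_) (S ⊆ᵇ_) (λ _ → refl)

⊆ᵇ-++ : ∀ {a b} (S₁ B : Subset a) (S₂ C : Subset b) → (S₁ ++ S₂) ⊆ᵇ (B ++ C) ≡ S₁ ⊆ᵇ B ∧ S₂ ⊆ᵇ C
⊆ᵇ-++ []          []          S₂ C = refl
⊆ᵇ-++ (false ∷ S₁) (_ ∷ B)    S₂ C = ⊆ᵇ-++ S₁ B S₂ C
⊆ᵇ-++ (true ∷ S₁)  (false ∷ B) S₂ C = refl
⊆ᵇ-++ (true ∷ S₁)  (true ∷ B)  S₂ C = ⊆ᵇ-++ S₁ B S₂ C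

size-zero : ∀ {n} (S : Subset n) → ∣ S ∣ ≡ 0 → S ≡ ⊥
size-zero []          _       = refl
size-zero (false ∷ S) ∣S∣≡0 = cong (false ∷_) (size-zero S ∣S∣≡0)

size-one : ∀ {n} (S : Subset n) → ∣ S ∣ ≡ 1 → ∃[ x ] S ≡ ⁅ x ⁆
size-one (true ∷ S)  ∣S∣≡1 = zero , cong (true ∷_) (size-zero S (suc-injective ∣S∣≡1))
size-one (false ∷ S) ∣S∣≡1 with size-one S ∣S∣≡1
... | x , refl = suc x , refl

size-two : ∀ {n} (S : Subset n) → ∣ S ∣ ≡ 2 → ∃[ x ] ∃[ y ] (x ≢ y × S ≡ ⁅ x ⁆ ∪ ⁅ y ⁆)
size-two (true ∷ S)  ∣S∣≡2 with size-one S (suc-injective ∣S∣≡2)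
... | y , refl = zero , suc y , (λ ()) , cong (true ∷_) (sym (∪-identityˡ ⁅ y ⁆))
size-two (false ∷ S) ∣S∣≡2 with size-two S ∣S∣≡2
... | x , y , x≢y , refl = suc x , suc y , (λ sx≡sy → x≢y (fsuc-injective sx≡sy)) , refl

empty-⊆ᵇ : ∀ {n} (S C : Subset n) → ∣ S ∣ ≡ 0 → S ⊆ᵇ C ≡ true
empty-⊆ᵇ S C ∣S∣≡0 = dec-true (S ⊆? C) (subst (_⊆ C) (sym (size-zero S ∣S∣≡0)) (⊆-min C))

nonempty-⊆ᵇ⊥ : ∀ {n} (S : Subset n) → ¬ ∣ S ∣ ≡ 0 → S ⊆ᵇ ⊥ ≡ false
nonempty-⊆ᵇ⊥ {n} S ∣S∣≢0 = dec-false (S ⊆? ⊥) λ S⊆⊥ →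
  ∣S∣≢0 (n≤0⇒n≡0 (subst (∣ S ∣ ≤_) (∣⊥∣≡0 n) (p⊆q⇒∣p∣≤∣q∣ S⊆⊥)))

size-++ : ∀ {a b} (S₁ : Subset a) (S₂ : Subset b) → ∣ S₁ ++ S₂ ∣ ≡ ∣ S₁ ∣ + ∣ S₂ ∣
size-++ []          S₂ = refl
size-++ (true ∷ S₁)  S₂ = cong suc (size-++ S₁ S₂)
size-++ (false ∷ S₁) S₂ = size-++ S₁ S₂

-- A 3-way 4-homogeneous (v,3,2) trade in which no pair of points lies in two blocks of one
-- collection.  As every point is covered, this is the same as a 4-homogeneous Steiner trade.
PairSteiner : ∀ {v} → Trade 3 v 3 2 → Set
PairSteiner {v} T = ∀ (S : Subset v) → ∣ S ∣ ≡ 2 → ∀ i → countContaining S (blocks T i) ≤ 1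

SteinerTrade : ℕ → Set
SteinerTrade v = Σ (Trade 3 v 3 2) λ T → PairSteiner T × IsHomogeneous 4 T

↑-view : ∀ {a b} (x : Fin (a + b)) → (∃[ i ] x ≡ i ↑ˡ b) ⊎ (∃[ j ] x ≡ a ↑ʳ j)
↑-view {a} x with splitAt a x in eq
... | inj₁ i = inj₁ (i , sym (splitAt⁻¹-↑ˡ eq))
... | inj₂ j = inj₂ (j , sym (splitAt⁻¹-↑ʳ eq))

module Juxtaposition {a b : ℕ} where

  inl : Subset a → Subset (a + b)
  inl B = B ++ ⊥

  inr : Subset b → Subset (a + b)
  inr C = ⊥ ++ C

  inl-injective : ∀ {B B′} → inl B ≡ inl B′ → B ≡ B′
  inl-injective {B} {B′} = ++-injectiveˡ B B′

  inr-injective : ∀ {C C′} → inr C ≡ inr C′ → C ≡ C′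
  inr-injective = ++-injectiveʳ (⊥ {a}) ⊥

  size-inl : ∀ B → ∣ inl B ∣ ≡ ∣ B ∣
  size-inl B = trans (size-++ B ⊥) (trans (cong (∣ B ∣ +_) (∣⊥∣≡0 b)) (+-identityʳ ∣ B ∣))

  size-inr : ∀ C → ∣ inr C ∣ ≡ ∣ C ∣
  size-inr C = trans (size-++ (⊥ {a}) C) (cong (_+ ∣ C ∣) (∣⊥∣≡0 a))

  inl≡inr⇒⊥ : ∀ {B C} → inl B ≡ inr C → B ≡ ⊥
  inl≡inr⇒⊥ {B} = ++-injectiveˡ B ⊥

  juxtapose : List (Subset a) → List (Subset b) → List (Subset (a + b))
  juxtapose Bs Cs = map inl Bs ++ₗ map inr Cs

  count-juxtapose : (f : Subset (a + b) → Bool) → ∀ Bs Cs →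
                    count f (juxtapose Bs Cs) ≡ count (λ B → f (inl B)) Bs + count (λ C → f (inr C)) Cs
  count-juxtapose f Bs Cs =
    trans (count-++ f (map inl Bs) _) (cong₂ _+_ (count-map f inl Bs) (count-map f inr Cs))

  pair-count : ∀ (S₁ : Subset a) (S₂ : Subset b) Bs Cs →
               countContaining (S₁ ++ S₂) (juxtapose Bs Cs) ≡
               count (λ B → S₁ ⊆ᵇ B ∧ S₂ ⊆ᵇ ⊥) Bs + count (λ C → S₁ ⊆ᵇ ⊥ ∧ S₂ ⊆ᵇ C) Cs
  pair-count S₁ S₂ Bs Cs = begin
    countContaining (S₁ ++ S₂) (juxtapose Bs Cs)
      ≡⟨ countContaining≡count (S₁ ++ S₂) (juxtapose Bs Cs) ⟩
    count ((S₁ ++ S₂) ⊆ᵇ_) (juxtapose Bs Cs)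
      ≡⟨ count-juxtapose ((S₁ ++ S₂) ⊆ᵇ_) Bs Cs ⟩
    count (λ B → (S₁ ++ S₂) ⊆ᵇ inl B) Bs + count (λ C → (S₁ ++ S₂) ⊆ᵇ inr C) Cs
      ≡⟨ cong₂ _+_ (count-cong (λ B → ⊆ᵇ-++ S₁ B S₂ ⊥) Bs) (count-cong (λ C → ⊆ᵇ-++ S₁ ⊥ S₂ C) Cs) ⟩
    count (λ B → S₁ ⊆ᵇ B ∧ S₂ ⊆ᵇ ⊥) Bs + count (λ C → S₁ ⊆ᵇ ⊥ ∧ S₂ ⊆ᵇ C) Cs ∎
    where open ≡-Reasoning

  left-pair-count : ∀ (S₁ : Subset a) (S₂ : Subset b) → ¬ ∣ S₁ ∣ ≡ 0 → ∣ S₂ ∣ ≡ 0 → ∀ Bs Cs →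
                    countContaining (S₁ ++ S₂) (juxtapose Bs Cs) ≡ countContaining S₁ Bs
  left-pair-count S₁ S₂ S₁≢∅ S₂≡∅ Bs Cs = begin
    countContaining (S₁ ++ S₂) (juxtapose Bs Cs)
      ≡⟨ pair-count S₁ S₂ Bs Cs ⟩
    count (λ B → S₁ ⊆ᵇ B ∧ S₂ ⊆ᵇ ⊥) Bs + count (λ C → S₁ ⊆ᵇ ⊥ ∧ S₂ ⊆ᵇ C) Cs
      ≡⟨ cong₂ _+_ (count-cong (λ B → trans (cong (S₁ ⊆ᵇ B ∧_) (empty-⊆ᵇ S₂ ⊥ S₂≡∅)) (∧-identityʳ _)) Bs)
                   (count-none (λ C → cong (_∧ S₂ ⊆ᵇ C) (nonempty-⊆ᵇ⊥ S₁ S₁≢∅)) Cs) ⟩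
    count (S₁ ⊆ᵇ_) Bs + 0
      ≡⟨ +-identityʳ _ ⟩
    count (S₁ ⊆ᵇ_) Bs
      ≡⟨ countContaining≡count S₁ Bs ⟨
    countContaining S₁ Bs ∎
    where open ≡-Reasoning

  right-pair-count : ∀ (S₁ : Subset a) (S₂ : Subset b) → ∣ S₁ ∣ ≡ 0 → ¬ ∣ S₂ ∣ ≡ 0 → ∀ Bs Cs →
                     countContaining (S₁ ++ S₂) (juxtapose Bs Cs) ≡ countContaining S₂ Cs
  right-pair-count S₁ S₂ S₁≡∅ S₂≢∅ Bs Cs = begin
    countContaining (S₁ ++ S₂) (juxtapose Bs Cs)
      ≡⟨ pair-count S₁ S₂ Bs Cs ⟩
    count (λ B → S₁ ⊆ᵇ B ∧ S₂ ⊆ᵇ ⊥) Bs + count (λ C → S₁ ⊆ᵇ ⊥ ∧ S₂ ⊆ᵇ C) Cs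
      ≡⟨ cong₂ _+_ (count-none (λ B → trans (cong (S₁ ⊆ᵇ B ∧_) (nonempty-⊆ᵇ⊥ S₂ S₂≢∅)) (∧-zeroʳ _)) Bs)
                   (count-cong (λ C → cong (_∧ S₂ ⊆ᵇ C) (empty-⊆ᵇ S₁ ⊥ S₁≡∅)) Cs) ⟩
    count (S₂ ⊆ᵇ_) Cs
      ≡⟨ countContaining≡count S₂ Cs ⟨
    countContaining S₂ Cs ∎
    where open ≡-Reasoning

  across-pair-count : ∀ (S₁ : Subset a) (S₂ : Subset b) → ¬ ∣ S₁ ∣ ≡ 0 → ¬ ∣ S₂ ∣ ≡ 0 → ∀ Bs Cs →
                      countContaining (S₁ ++ S₂) (juxtapose Bs Cs) ≡ 0
  across-pair-count S₁ S₂ S₁≢∅ S₂≢∅ Bs Cs = trans (pair-count S₁ S₂ Bs Cs)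
    (cong₂ _+_ (count-none (λ B → trans (cong (S₁ ⊆ᵇ B ∧_) (nonempty-⊆ᵇ⊥ S₂ S₂≢∅)) (∧-zeroʳ _)) Bs)
               (count-none (λ C → cong (_∧ S₂ ⊆ᵇ C) (nonempty-⊆ᵇ⊥ S₁ S₁≢∅)) Cs))

  data PairView (S : Subset (a + b)) : Set where
    on-left  : ∀ S₁ → ∣ S₁ ∣ ≡ 2 →
               (∀ Bs Cs → countContaining S (juxtapose Bs Cs) ≡ countContaining S₁ Bs) → PairView S
    on-right : ∀ S₂ → ∣ S₂ ∣ ≡ 2 →
               (∀ Bs Cs → countContaining S (juxtapose Bs Cs) ≡ countContaining S₂ Cs) → PairView S
    across   : (∀ Bs Cs → countContaining S (juxtapose Bs Cs) ≡ 0) → PairView S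

  pairView : ∀ S → ∣ S ∣ ≡ 2 → PairView S
  pairView S ∣S∣≡2 with Vec.splitAt a S
  ... | S₁ , S₂ , refl = classify ∣ S₁ ∣ ∣ S₂ ∣ refl refl (trans (sym (size-++ S₁ S₂)) ∣S∣≡2)
    where
    classify : ∀ s₁ s₂ → ∣ S₁ ∣ ≡ s₁ → ∣ S₂ ∣ ≡ s₂ → s₁ + s₂ ≡ 2 → PairView (S₁ ++ S₂)
    classify 0 _ e₁ e₂ refl = on-right S₂ e₂ (right-pair-count S₁ S₂ e₁ (nonzero e₂))
    classify 1 _ e₁ e₂ refl = across (across-pair-count S₁ S₂ (nonzero e₁) (nonzero e₂))
    classify 2 _ e₁ e₂ refl = on-left S₁ e₁ (left-pair-count S₁ S₂ (nonzero e₁) e₂)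
    classify (suc (suc (suc _))) _ _ _ ()

  degree-inl : ∀ (i : Fin a) Bs Cs → degree (i ↑ˡ b) (juxtapose Bs Cs) ≡ degree i Bs
  degree-inl i Bs Cs = begin
    degree (i ↑ˡ b) (juxtapose Bs Cs)
      ≡⟨ count-juxtapose (λ B → lookup B (i ↑ˡ b)) Bs Cs ⟩
    count (λ B → lookup (inl B) (i ↑ˡ b)) Bs + count (λ C → lookup (inr C) (i ↑ˡ b)) Cs
      ≡⟨ cong₂ _+_ (count-cong (λ B → lookup-++ˡ B ⊥ i) Bs)
                   (count-none (λ C → trans (lookup-++ˡ ⊥ C i) (lookup-replicate i false)) Cs) ⟩
    degree i Bs + 0
      ≡⟨ +-identityʳ _ ⟩
    degree i Bs ∎
    where open ≡-Reasoning

  degree-inr : ∀ (j : Fin b) Bs Cs → degree (a ↑ʳ j) (juxtapose Bs Cs) ≡ degree j Cs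
  degree-inr j Bs Cs = begin
    degree (a ↑ʳ j) (juxtapose Bs Cs)
      ≡⟨ count-juxtapose (λ B → lookup B (a ↑ʳ j)) Bs Cs ⟩
    count (λ B → lookup (inl B) (a ↑ʳ j)) Bs + count (λ C → lookup (inr C) (a ↑ʳ j)) Cs
      ≡⟨ cong₂ _+_ (count-none (λ B → trans (lookup-++ʳ B ⊥ j) (lookup-replicate j false)) Bs)
                   (count-cong (λ C → lookup-++ʳ (⊥ {a}) C j) Cs) ⟩
    degree j Cs ∎
    where open ≡-Reasoning

module DisjointUnion {a b : ℕ} (T₁ : Trade 3 a 3 2) (T₂ : Trade 3 b 3 2) where
  open Juxtaposition {a} {b}

  UB : Fin 3 → List (Subset (a + b))
  UB i = juxtapose (blocks T₁ i) (blocks T₂ i)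

  -- A left block is nonempty, so it is never a right block.
  left-not-right : ∀ i j {X} → X List.∈ map inl (blocks T₁ i) → ¬ X List.∈ map inr (blocks T₂ j)
  left-not-right i j X∈left X∈right with ∈-map⁻ inl X∈left | ∈-map⁻ inr X∈right
  ... | B , B∈T₁ , refl | C , _ , inlB≡inrC = 3≢0 (begin
    3         ≡⟨ All.lookup (isBlock T₁ i) B∈T₁ ⟨
    ∣ B ∣     ≡⟨ cong ∣_∣ (inl≡inr⇒⊥ inlB≡inrC) ⟩
    ∣ ⊥ {a} ∣ ≡⟨ ∣⊥∣≡0 a ⟩
    0         ∎)
    where
    open ≡-Reasoning
    3≢0 : ¬ 3 ≡ 0
    3≢0 ()

  disjoint-collections : ∀ i j → i ≢ j → ∀ X → X List.∈ UB i → ¬ X List.∈ UB j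
  disjoint-collections i j i≢j X X∈i X∈j
    with ∈-++⁻ (map inl (blocks T₁ i)) X∈i | ∈-++⁻ (map inl (blocks T₁ j)) X∈j
  ... | inj₁ X∈left | inj₂ X∈right = left-not-right i j X∈left X∈right
  ... | inj₂ X∈right | inj₁ X∈left = left-not-right j i X∈left X∈right
  ... | inj₁ X∈left | inj₁ X∈left′ with ∈-map⁻ inl X∈left | ∈-map⁻ inl X∈left′
  ...   | B , B∈i , refl | B′ , B′∈j , inlB≡inlB′ =
    disjoint T₁ i j i≢j B B∈i (subst (List._∈ blocks T₁ j) (sym (inl-injective inlB≡inlB′)) B′∈j)
  disjoint-collections i j i≢j X X∈i X∈j | inj₂ X∈right | inj₂ X∈right′
    with ∈-map⁻ inr X∈right | ∈-map⁻ inr X∈right′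
  ...   | C , C∈i , refl | C′ , C′∈j , inrC≡inrC′ =
    disjoint T₂ i j i≢j C C∈i (subst (List._∈ blocks T₂ j) (sym (inr-injective inrC≡inrC′)) C′∈j)

  -- Pair counts agree across the collections: by pairView they are pair counts of one of
  -- the two trades, or all zero.
  balanced-pairs : ∀ S → ∣ S ∣ ≡ 2 → ∀ i j → countContaining S (UB i) ≡ countContaining S (UB j)
  balanced-pairs S ∣S∣≡2 i j with pairView S ∣S∣≡2
  ... | on-left S₁ ∣S₁∣≡2 reduce = trans (reduce (blocks T₁ i) (blocks T₂ i))
    (trans (balanced T₁ S₁ ∣S₁∣≡2 i j) (sym (reduce (blocks T₁ j) (blocks T₂ j))))
  ... | on-right S₂ ∣S₂∣≡2 reduce = trans (reduce (blocks T₁ i) (blocks T₂ i))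
    (trans (balanced T₂ S₂ ∣S₂∣≡2 i j) (sym (reduce (blocks T₁ j) (blocks T₂ j))))
  ... | across none = trans (none (blocks T₁ i) (blocks T₂ i)) (sym (none (blocks T₁ j) (blocks T₂ j)))

  U : Trade 3 (a + b) 3 2
  U = record
    { blocks   = UB
    ; volume   = volume T₁ + volume T₂
    ; size     = λ i → trans (length-++ (map inl (blocks T₁ i)))
                             (cong₂ _+_ (trans (length-map inl (blocks T₁ i)) (size T₁ i))
                                        (trans (length-map inr (blocks T₂ i)) (size T₂ i)))
    ; distinct = λ i → Unique.++⁺ (Unique.map⁺ inl-injective (distinct T₁ i))
                                  (Unique.map⁺ inr-injective (distinct T₂ i))
                                  (λ (X∈left , X∈right) → left-not-right i i X∈left X∈right)
    ; isBlock  = λ i → All.++⁺ (All.map⁺ (All.map (λ {B} → trans (size-inl B)) (isBlock T₁ i)))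
                               (All.map⁺ (All.map (λ {C} → trans (size-inr C)) (isBlock T₂ i)))
    ; disjoint = disjoint-collections
    ; balanced = balanced-pairs
    }

  union-steiner : PairSteiner T₁ → PairSteiner T₂ → PairSteiner U
  union-steiner steiner₁ steiner₂ S ∣S∣≡2 i with pairView S ∣S∣≡2
  ... | on-left S₁ ∣S₁∣≡2 reduce = subst (_≤ 1) (sym (reduce (blocks T₁ i) (blocks T₂ i))) (steiner₁ S₁ ∣S₁∣≡2 i)
  ... | on-right S₂ ∣S₂∣≡2 reduce = subst (_≤ 1) (sym (reduce (blocks T₁ i) (blocks T₂ i))) (steiner₂ S₂ ∣S₂∣≡2 i)
  ... | across none = subst (_≤ 1) (sym (none (blocks T₁ i) (blocks T₂ i))) z≤n

  union-homogeneous : ∀ {d} → IsHomogeneous d T₁ → IsHomogeneous d T₂ → IsHomogeneous d U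
  union-homogeneous {d} hom₁ hom₂ x i with ↑-view {a} {b} x
  ... | inj₁ (k , refl) = begin
    countPoint (k ↑ˡ b) (UB i)  ≡⟨ countPoint≡degree (k ↑ˡ b) (UB i) ⟩
    degree (k ↑ˡ b) (UB i)      ≡⟨ degree-inl k (blocks T₁ i) (blocks T₂ i) ⟩
    degree k (blocks T₁ i)      ≡⟨ countPoint≡degree k (blocks T₁ i) ⟨
    countPoint k (blocks T₁ i)  ≡⟨ hom₁ k i ⟩
    d                           ∎
    where open ≡-Reasoning
  ... | inj₂ (k , refl) = begin
    countPoint (a ↑ʳ k) (UB i)  ≡⟨ countPoint≡degree (a ↑ʳ k) (UB i) ⟩
    degree (a ↑ʳ k) (UB i)      ≡⟨ degree-inr k (blocks T₁ i) (blocks T₂ i) ⟩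
    degree k (blocks T₂ i)      ≡⟨ countPoint≡degree k (blocks T₂ i) ⟨
    countPoint k (blocks T₂ i)  ≡⟨ hom₂ k i ⟩
    d                           ∎
    where open ≡-Reasoning

union : ∀ {a b} → SteinerTrade a → SteinerTrade b → SteinerTrade (a + b)
union (T₁ , steiner₁ , hom₁) (T₂ , steiner₂ , hom₂) =
  U , union-steiner steiner₁ steiner₂ , union-homogeneous hom₁ hom₂
  where open DisjointUnion T₁ T₂

module Certificates {v : ℕ} where

  open import Data.List.Relation.Unary.Unique.DecPropositional (≡-dec {n = v} Bool._≟_) using (unique?)
  open import Data.List.Membership.DecPropositional (≡-dec {n = v} Bool._≟_) using () renaming (_∈?_ to _∈ₗ?_)

  Certificate : (Fin 3 → List (Subset v)) → Set
  Certificate Bs =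
      (∀ i → length (Bs i) ≡ length (Bs zero))
    × (∀ i → Unique (Bs i))
    × (∀ i → All (λ B → ∣ B ∣ ≡ 3) (Bs i))
    × (∀ i j → i ≢ j → All (λ B → ¬ B List.∈ Bs j) (Bs i))
    × (∀ x y i → codegree x y (Bs i) ≡ codegree x y (Bs zero))
    × (∀ x y → x ≢ y → ∀ i → codegree x y (Bs i) ≤ 1)
    × (∀ x i → degree x (Bs i) ≡ 4)

  certificate? : ∀ Bs → Dec (Certificate Bs)
  certificate? Bs =
          all? (λ i → length (Bs i) ℕ.≟ length (Bs zero))
    ×-dec all? (λ i → unique? (Bs i))
    ×-dec all? (λ i → All.all? (λ B → ∣ B ∣ ℕ.≟ 3) (Bs i))
    ×-dec all? (λ i → all? (λ j → ¬? (i Fin.≟ j) →-dec All.all? (λ B → ¬? (B ∈ₗ? Bs j)) (Bs i)))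
    ×-dec all? (λ x → all? (λ y → all? (λ i → codegree x y (Bs i) ℕ.≟ codegree x y (Bs zero))))
    ×-dec all? (λ x → all? (λ y → ¬? (x Fin.≟ y) →-dec all? (λ i → codegree x y (Bs i) ≤? 1)))
    ×-dec all? (λ x → all? (λ i → degree x (Bs i) ℕ.≟ 4))

  fromCertificate : ∀ Bs → Certificate Bs → SteinerTrade v
  fromCertificate Bs (same-length , unique , triples , unshared , pair-balanced , pair-steiner , degree-four) =
    U , steiner , homogeneous
    where
    balanced-pairs : ∀ S → ∣ S ∣ ≡ 2 → ∀ i j → countContaining S (Bs i) ≡ countContaining S (Bs j)
    balanced-pairs S ∣S∣≡2 i j with size-two S ∣S∣≡2
    ... | x , y , _ , refl = begin
      countContaining (⁅ x ⁆ ∪ ⁅ y ⁆) (Bs i)  ≡⟨ countPair≡codegree x y (Bs i) ⟩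
      codegree x y (Bs i)                      ≡⟨ pair-balanced x y i ⟩
      codegree x y (Bs zero)                   ≡⟨ pair-balanced x y j ⟨
      codegree x y (Bs j)                      ≡⟨ countPair≡codegree x y (Bs j) ⟨
      countContaining (⁅ x ⁆ ∪ ⁅ y ⁆) (Bs j)  ∎
      where open ≡-Reasoning

    U : Trade 3 v 3 2
    U = record
      { blocks   = Bs
      ; volume   = length (Bs zero)
      ; size     = same-length
      ; distinct = unique
      ; isBlock  = triples
      ; disjoint = λ i j i≢j B B∈i → All.lookup (unshared i j i≢j) B∈i
      ; balanced = balanced-pairs
      }

    steiner : PairSteiner U
    steiner S ∣S∣≡2 i with size-two S ∣S∣≡2
    ... | x , y , x≢y , refl = subst (_≤ 1) (sym (countPair≡codegree x y (Bs i))) (pair-steiner x y x≢y i)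

    homogeneous : IsHomogeneous 4 U
    homogeneous x i = trans (countPoint≡degree x (Bs i)) (degree-four x i)

-- Explicit trades on 9, 12 and 15 points (numeric literals denote points of Fin v),
-- each proved correct by evaluating certificate? on it.
module Examples where
  open import Agda.Builtin.FromNat using (Number; fromNat)
  import Data.Fin.Literals as Fin-literals
  import Data.Nat.Literals as ℕ-literals

  instance
    nat-number : Number ℕ
    nat-number = ℕ-literals.number
    fin-number : ∀ {n} → Number (Fin n)
    fin-number {n} = Fin-literals.number n

  block : ∀ {v} → Fin v → Fin v → Fin v → Subset v
  block x y z = ⁅ x ⁆ ∪ ⁅ y ⁆ ∪ ⁅ z ⁆

  trade9 : Fin 3 → List (Subset 9)
  trade9 zero =
    block 0 1 4 ∷ block 0 2 8 ∷ block 0 3 7 ∷ block 0 5 6 ∷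
    block 1 2 3 ∷ block 1 5 8 ∷ block 1 6 7 ∷ block 2 4 6 ∷
    block 2 5 7 ∷ block 3 4 5 ∷ block 3 6 8 ∷ block 4 7 8 ∷ []
  trade9 (suc zero) =
    block 0 1 7 ∷ block 0 2 3 ∷ block 0 4 6 ∷ block 0 5 8 ∷
    block 1 2 8 ∷ block 1 3 6 ∷ block 1 4 5 ∷ block 2 4 7 ∷
    block 2 5 6 ∷ block 3 4 8 ∷ block 3 5 7 ∷ block 6 7 8 ∷ []
  trade9 (suc (suc zero)) =
    block 0 1 8 ∷ block 0 2 6 ∷ block 0 3 5 ∷ block 0 4 7 ∷
    block 1 2 7 ∷ block 1 3 4 ∷ block 1 5 6 ∷ block 2 3 8 ∷
    block 2 4 5 ∷ block 3 6 7 ∷ block 4 6 8 ∷ block 5 7 8 ∷ []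

  steiner9 : SteinerTrade 9
  steiner9 = Certificates.fromCertificate trade9 (toWitness {a? = Certificates.certificate? trade9} tt)

  trade12 : Fin 3 → List (Subset 12)
  trade12 zero =
    block 0 1 5 ∷ block 0 2 6 ∷ block 0 3 8 ∷ block 0 10 11 ∷
    block 1 2 8 ∷ block 1 4 6 ∷ block 1 9 10 ∷ block 2 3 9 ∷
    block 2 7 11 ∷ block 3 4 11 ∷ block 3 7 10 ∷ block 4 5 10 ∷
    block 4 8 9 ∷ block 5 6 11 ∷ block 5 7 8 ∷ block 6 7 9 ∷ []
  trade12 (suc zero) =
    block 0 1 2 ∷ block 0 3 10 ∷ block 0 5 8 ∷ block 0 6 11 ∷
    block 1 4 8 ∷ block 1 5 10 ∷ block 1 6 9 ∷ block 2 3 11 ∷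
    block 2 6 7 ∷ block 2 8 9 ∷ block 3 4 9 ∷ block 3 7 8 ∷
    block 4 5 6 ∷ block 4 10 11 ∷ block 5 7 11 ∷ block 7 9 10 ∷ []
  trade12 (suc (suc zero)) =
    block 0 1 6 ∷ block 0 2 8 ∷ block 0 3 11 ∷ block 0 5 10 ∷
    block 1 2 9 ∷ block 1 4 10 ∷ block 1 5 8 ∷ block 2 3 7 ∷
    block 2 6 11 ∷ block 3 4 8 ∷ block 3 9 10 ∷ block 4 5 11 ∷
    block 4 6 9 ∷ block 5 6 7 ∷ block 7 8 9 ∷ block 7 10 11 ∷ []

  steiner12 : SteinerTrade 12
  steiner12 = Certificates.fromCertificate trade12 (toWitness {a? = Certificates.certificate? trade12} tt)

  trade15 : Fin 3 → List (Subset 15)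
  trade15 zero =
    block 0 5 10 ∷ block 1 6 11 ∷ block 2 7 12 ∷ block 3 8 13 ∷
    block 4 9 14 ∷ block 0 6 12 ∷ block 1 7 13 ∷ block 2 8 14 ∷
    block 3 9 10 ∷ block 4 5 11 ∷ block 0 7 14 ∷ block 1 8 10 ∷
    block 2 9 11 ∷ block 3 5 12 ∷ block 4 6 13 ∷ block 0 8 11 ∷
    block 1 9 12 ∷ block 2 5 13 ∷ block 3 6 14 ∷ block 4 7 10 ∷ []
  trade15 (suc zero) =
    block 0 5 11 ∷ block 1 6 12 ∷ block 2 7 13 ∷ block 3 8 14 ∷
    block 4 9 10 ∷ block 0 6 14 ∷ block 1 7 10 ∷ block 2 8 11 ∷
    block 3 9 12 ∷ block 4 5 13 ∷ block 0 7 12 ∷ block 1 8 13 ∷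
    block 2 9 14 ∷ block 3 5 10 ∷ block 4 6 11 ∷ block 0 8 10 ∷
    block 1 9 11 ∷ block 2 5 12 ∷ block 3 6 13 ∷ block 4 7 14 ∷ []
  trade15 (suc (suc zero)) =
    block 0 5 12 ∷ block 1 6 13 ∷ block 2 7 14 ∷ block 3 8 10 ∷
    block 4 9 11 ∷ block 0 6 11 ∷ block 1 7 12 ∷ block 2 8 13 ∷
    block 3 9 14 ∷ block 4 5 10 ∷ block 0 7 10 ∷ block 1 8 11 ∷
    block 2 9 12 ∷ block 3 5 13 ∷ block 4 6 14 ∷ block 0 8 14 ∷
    block 1 9 10 ∷ block 2 5 11 ∷ block 3 6 12 ∷ block 4 7 13 ∷ []

  steiner15 : SteinerTrade 15
  steiner15 = Certificates.fromCertificate trade15 (toWitness {a? = Certificates.certificate? trade15} tt)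

steiner-multiple : ∀ k → SteinerTrade ((3 + k) * 3)
steiner-multiple 0 = Examples.steiner9
steiner-multiple 1 = Examples.steiner12
steiner-multiple 2 = Examples.steiner15
steiner-multiple (suc (suc (suc k))) =
  subst SteinerTrade (add-nine k) (union (steiner-multiple k) Examples.steiner9)
  where
  add-nine : ∀ k → (3 + k) * 3 + 9 ≡ (3 + (3 + k)) * 3
  add-nine = solve-∀

sufficiency : ∀ v → 9 ≤ v → v % 3 ≡ 0 → SteinerTrade v
sufficiency v 9≤v v%3≡0 with m%n≡0⇒n∣m v 3 v%3≡0
... | divides q refl = subst (λ p → SteinerTrade (p * 3)) (m+[n∸m]≡n 3≤q) (steiner-multiple (q ∸ 3))
  where
  3≤q : 3 ≤ q
  3≤q = *-cancelʳ-≤ 3 q 3 9≤v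

theorem3p2 : ∀ (v : ℕ) → 3 < v →
    (∃[ T ] (IsSteiner {3} {v} {3} {2} T × IsHomogeneous 4 T)) ⇔ (9 ≤ v × v % 3 ≡ 0)
theorem3p2 (suc n) _ = mk⇔ necessary sufficient
  where
  necessary : ∃[ T ] (IsSteiner T × IsHomogeneous 4 T) → 9 ≤ suc n × suc n % 3 ≡ 0
  necessary (T , steiner , hom) = at-least-nine T steiner hom , Necessity.divisible T hom
  sufficient : 9 ≤ suc n × suc n % 3 ≡ 0 → ∃[ T ] (IsSteiner T × IsHomogeneous 4 T)
  sufficient (9≤v , v%3≡0) with sufficiency (suc n) 9≤v v%3≡0
  ... | T , steiner , hom = T , (λ S ∣S∣≡2 _ → steiner S ∣S∣≡2) , hom
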